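{- The smallest integer $k$ such that there exists a Septoku puzzle with $k$ seeds having a unique solution is $k=6$. That is: every set of at most five seeds is extended by either zero or at least two valid Septoku boards, and there exists a set of six seeds extended by exactly one valid Septoku board.
   Context: The Septoku board consists of 37 cells forming a regular hexagon of side 4 in a hexagonal grid, numbered row by row: $1$–$4$ (top row), $5$–$9$, $10$–$15$, $16$–$22$, $23$–$28$, $29$–$33$, $34$–$37$ (bottom row). The 21 "rows" of the board are: horizontal $\{1,2,3,4\}$, $\{5,\dots,9\}$, $\{10,\dots,15\}$, $\{16,\dots,22\}$, $\{23,\dots,28\}$, $\{29,\dots,33\}$, $\{34,\dots,37\}$; up-right $\{1,5,10,16\}$, $\{2,6,11,17,23\}$, $\{3,7,12,18,24,29\}$, $\{4,8,13,19,25,30,34\}$, $\{9,14,20,26,31,35\}$, $\{15,21,27,32,36\}$, $\{22,28,33,37\}$; down-right $\{4,9,15,22\}$, $\{3,8,14,21,28\}$, $\{2,7,13,20,27,33\}$, $\{1,6,12,19,26,32,37\}$, $\{5,11,18,25,31,36\}$, $\{10,17,24,30,35\}$, $\{16,23,29,34\}$. The seven "circles" are: $\{1,2,5,6,7,11,12\}$, $\{3,4,7,8,9,13,14\}$, $\{10,11,16,17,18,23,24\}$, $\{12,13,18,19,20,25,26\}$, $\{14,15,20,21,22,27,28\}$, $\{24,25,29,30,31,34,35\}$, $\{26,27,31,32,33,36,37\}$. A valid Septoku board is a map $s:\{1,\dots,37\}\to\{1,\dots,7\}$ such that the cells of each of the 21 rows receive pairwise distinct values and the seven cells of each circle receive pairwise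 distinct values. A Septoku puzzle with $k$ seeds is a partial map $p: S\to\{1,\dots,7\}$ with $S\subseteq\{1,\dots,37\}$, $|S|=k$; a solution is a valid board $s$ with $s|_S=p$, and the puzzle has a unique solution if exactly one such valid board exists. -}

module Defs where

open import Data.Nat using (ℕ; _∸_; _<?_)
open import Data.Fin using (Fin; fromℕ<; zero)
open import Data.List using (List; []; _∷_; map)
open import Data.List.Relation.Unary.All using (All)
open import Data.List.Relation.Unary.Unique.Propositional using (Unique)
open import Data.Product using (_×_; _,_; proj₁; proj₂; Σ)
open import Relation.Binary.PropositionalEquality using (_≡_)
open import Relation.Nullary using (yes; no)

-- Cells 1..37 are represented by Fin 37 (cell n ↦ index n - 1);
-- values 1..7 are represented by Fin 7 (value v ↦ index v - 1).
Cell : Set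
Cell = Fin 37

Value : Set
Value = Fin 7

Board : Set
Board = Cell → Value

-- convert the paper's 1-based cell numbers to Cell (only used on 1..37)
toCell : ℕ → Cell
toCell n with (n ∸ 1) <? 37
... | yes p = fromℕ< p
... | no _  = zero

rows : List (List ℕ)
rows =
  -- horizontal
  (1 ∷ 2 ∷ 3 ∷ 4 ∷ []) ∷
  (5 ∷ 6 ∷ 7 ∷ 8 ∷ 9 ∷ []) ∷
  (10 ∷ 11 ∷ 12 ∷ 13 ∷ 14 ∷ 15 ∷ []) ∷
  (16 ∷ 17 ∷ 18 ∷ 19 ∷ 20 ∷ 21 ∷ 22 ∷ []) ∷
  (23 ∷ 24 ∷ 25 ∷ 26 ∷ 27 ∷ 28 ∷ []) ∷
  (29 ∷ 30 ∷ 31 ∷ 32 ∷ 33 ∷ []) ∷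
  (34 ∷ 35 ∷ 36 ∷ 37 ∷ []) ∷
  -- up-right
  (1 ∷ 5 ∷ 10 ∷ 16 ∷ []) ∷
  (2 ∷ 6 ∷ 11 ∷ 17 ∷ 23 ∷ []) ∷
  (3 ∷ 7 ∷ 12 ∷ 18 ∷ 24 ∷ 29 ∷ []) ∷
  (4 ∷ 8 ∷ 13 ∷ 19 ∷ 25 ∷ 30 ∷ 34 ∷ []) ∷
  (9 ∷ 14 ∷ 20 ∷ 26 ∷ 31 ∷ 35 ∷ []) ∷
  (15 ∷ 21 ∷ 27 ∷ 32 ∷ 36 ∷ []) ∷
  (22 ∷ 28 ∷ 33 ∷ 37 ∷ []) ∷
  -- down-right
  (4 ∷ 9 ∷ 15 ∷ 22 ∷ []) ∷
  (3 ∷ 8 ∷ 14 ∷ 21 ∷ 28 ∷ []) ∷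
  (2 ∷ 7 ∷ 13 ∷ 20 ∷ 27 ∷ 33 ∷ []) ∷
  (1 ∷ 6 ∷ 12 ∷ 19 ∷ 26 ∷ 32 ∷ 37 ∷ []) ∷
  (5 ∷ 11 ∷ 18 ∷ 25 ∷ 31 ∷ 36 ∷ []) ∷
  (10 ∷ 17 ∷ 24 ∷ 30 ∷ 35 ∷ []) ∷
  (16 ∷ 23 ∷ 29 ∷ 34 ∷ []) ∷
  []

circles : List (List ℕ)
circles =
  (1 ∷ 2 ∷ 5 ∷ 6 ∷ 7 ∷ 11 ∷ 12 ∷ []) ∷
  (3 ∷ 4 ∷ 7 ∷ 8 ∷ 9 ∷ 13 ∷ 14 ∷ []) ∷
  (10 ∷ 11 ∷ 16 ∷ 17 ∷ 18 ∷ 23 ∷ 24 ∷ []) ∷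
  (12 ∷ 13 ∷ 18 ∷ 19 ∷ 20 ∷ 25 ∷ 26 ∷ []) ∷
  (14 ∷ 15 ∷ 20 ∷ 21 ∷ 22 ∷ 27 ∷ 28 ∷ []) ∷
  (24 ∷ 25 ∷ 29 ∷ 30 ∷ 31 ∷ 34 ∷ 35 ∷ []) ∷
  (26 ∷ 27 ∷ 31 ∷ 32 ∷ 33 ∷ 36 ∷ 37 ∷ []) ∷
  []

Distinct : Board → List ℕ → Set
Distinct s g = Unique (map s (map toCell g))

ValidBoard : Board → Set
ValidBoard s = All (Distinct s) rows × All (Distinct s) circles

-- A puzzle: a list of seeds (cell, value) with pairwise distinct cells,
-- i.e. a partial map S → Value with |S| = length of the list.
Puzzle : Set
Puzzle = List (Cell × Value)

WellFormed : Puzzle → Set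
WellFormed p = Unique (map proj₁ p)

Extends : Board → Puzzle → Set
Extends s p = All (λ cv → s (proj₁ cv) ≡ proj₂ cv) p

Solution : Puzzle → Board → Set
Solution p s = ValidBoard s × Extends s p

-- exactly one valid board extends p (boards compared pointwise)
HasUniqueSolution : Puzzle → Set
HasUniqueSolution p =
  Σ Board (λ s → Solution p s × (∀ t → Solution p t → ∀ c → t c ≡ s c))

-- Five seeds use at most five of the seven values. Exchanging two unused values in a solution
-- gives another solution, and a different one, because every circle carries all seven values.
-- For the six seeds below, the remaining 31 cells are filled one by one as naked singles (the
-- six other values already occur among decided peers); this chain is certified by evaluating a
-- decision procedure, and its soundness makes every solution equal to the exhibited one.
module Submission where

open import Defs
open import Data.Nat using (ℕ; suc; _≤_; _+_; z≤n; s≤s)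
import Data.Nat as ℕ
open import Data.Nat.Properties using (≤-trans; ≤-reflexive; +-cancelˡ-≤; +-monoˡ-≤; n≮n)
open import Data.Fin using (Fin; toℕ; #_)
open import Data.Fin.Properties using (_≟_; all?; toℕ<n; fromℕ<-toℕ)
open import Data.Fin.Permutation using (Permutation′; _⟨$⟩ʳ_; _⟨$⟩ˡ_; inverseˡ; transpose)
import Data.Fin.Permutation.Components as PC
open import Data.List using (List; []; _∷_; length; map; filter; allFin; _++_)
open import Data.List.Properties using (length-map; length-++; length-tabulate; length-removeAt′; map-∘)
open import Data.List.Relation.Unary.All as All using (All; []; _∷_)
open import Data.List.Relation.Unary.All.Properties using (¬Any⇒All¬) renaming (map⁺ to All-map⁺; map⁻ to All-map⁻; ++⁺ to All-++⁺)
open import Data.List.Relation.Unary.Any as Any using (Any; here; there; index; _─_)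
open import Data.List.Relation.Unary.AllPairs using ([]; _∷_)
open import Data.List.Relation.Unary.Unique.Propositional using (Unique)
import Data.List.Relation.Unary.Unique.Propositional.Properties as Unique
import Data.List.Relation.Unary.Unique.DecPropositional as DecUnique
open import Data.List.Relation.Binary.Subset.Propositional using (_⊆_)
open import Data.List.Membership.Propositional using (_∈_; _∉_)
open import Data.List.Membership.Propositional.Properties using (∈-allFin; ∈-map⁻; ∈-filter⁺; ∈-filter⁻; ∈-++⁺ˡ; ∈-++⁺ʳ)
import Data.List.Membership.DecPropositional as DecMembership
open DecMembership ℕ._≟_ using () renaming (_∈?_ to _ℕ∈?_)
open import Data.Vec as Vec using ([]; _∷_)
open import Data.Product using (_×_; _,_; proj₁; proj₂; Σ; ∃-syntax)
open import Data.Empty using (⊥; ⊥-elim)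
open import Data.Unit using (⊤; tt)
open import Data.Sum using (_⊎_; inj₁; inj₂)
open import Function using (_∘_)
open import Relation.Nullary using (¬_; Dec; yes; no; ¬?)
open import Relation.Nullary.Decidable using (dec-true; dec-false; _×-dec_; _⊎-dec_; from-yes)
open import Relation.Binary.PropositionalEquality using (_≡_; _≢_; refl; sym; trans; cong; subst; ≢-sym; module ≡-Reasoning)

module _ {A : Set} where

  ∈-─⁺ : ∀ {x y} {ys : List A} (x∈ys : x ∈ ys) → y ∈ ys → y ≢ x → y ∈ (ys ─ x∈ys)
  ∈-─⁺ (here refl) (here refl) y≢x = ⊥-elim (y≢x refl)
  ∈-─⁺ (here refl) (there y∈ys) _  = y∈ys
  ∈-─⁺ (there _)   (here refl) _   = here refl
  ∈-─⁺ (there x∈ys) (there y∈ys) y≢x = there (∈-─⁺ x∈ys y∈ys y≢x)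

  Unique-⊆⇒length≤ : ∀ {xs ys : List A} → Unique xs → xs ⊆ ys → length xs ≤ length ys
  Unique-⊆⇒length≤ [] _ = z≤n
  Unique-⊆⇒length≤ {x ∷ xs} {ys} (x∉xs ∷ xs!) xs⊆ys =
    ≤-trans (s≤s (Unique-⊆⇒length≤ xs! step)) (≤-reflexive (sym (length-removeAt′ ys (index x∈ys))))
    where
    x∈ys : x ∈ ys
    x∈ys = xs⊆ys (here refl)
    step : xs ⊆ (ys ─ x∈ys)
    step y∈xs = ∈-─⁺ x∈ys (xs⊆ys (there y∈xs)) (≢-sym (All.lookup x∉xs y∈xs))

module _ {A B : Set} (f : A → B) where

  Unique-map⇒≢ : ∀ {xs x y} → Unique (map f xs) → x ∈ xs → y ∈ xs → x ≢ y → f x ≢ f y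
  Unique-map⇒≢ (_ ∷ _)   (here refl) (here refl) x≢y = ⊥-elim (x≢y refl)
  Unique-map⇒≢ (fx∉ ∷ _) (here refl) (there y∈xs) _ = All.lookup (All-map⁻ fx∉) y∈xs
  Unique-map⇒≢ (fy∉ ∷ _) (there x∈xs) (here refl) _ = ≢-sym (All.lookup (All-map⁻ fy∉) x∈xs)
  Unique-map⇒≢ (_ ∷ u)   (there x∈xs) (there y∈xs) x≢y = Unique-map⇒≢ u x∈xs y∈xs x≢y

module _ {n : ℕ} where

  open DecMembership (_≟_ {n}) using (_∈?_)

  length-allFin : length (allFin n) ≡ n
  length-allFin = length-tabulate (λ i → i)

  allFin⊆⇒n≤length : {ys : List (Fin n)} → allFin n ⊆ ys → n ≤ length ys
  allFin⊆⇒n≤length ⊆ys = ≤-trans (≤-reflexive (sym length-allFin)) (Unique-⊆⇒length≤ (Unique.allFin⁺ n) ⊆ys)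

  Unique⇒length≤ : {xs : List (Fin n)} → Unique xs → length xs ≤ n
  Unique⇒length≤ xs! = ≤-trans (Unique-⊆⇒length≤ xs! (λ {v} _ → ∈-allFin v)) (≤-reflexive length-allFin)

  Unique∧length≡⇒∈ : {xs : List (Fin n)} → Unique xs → length xs ≡ n → ∀ v → v ∈ xs
  Unique∧length≡⇒∈ {xs} xs! len v with v ∈? xs
  ... | yes v∈xs = v∈xs
  ... | no  v∉xs = ⊥-elim (n≮n n (subst (_≤ n) (cong suc len) (Unique⇒length≤ (¬Any⇒All¬ xs v∉xs ∷ xs!))))

  two-∉ : (vs : List (Fin n)) → length vs + 2 ≤ n → ∃[ a ] ∃[ b ] a ≢ b × a ∉ vs × b ∉ vs
  two-∉ vs len = first-two unused unused! (All.tabulate (λ u∈ → proj₂ (∈-filter⁻ unused? {xs = allFin n} u∈))) enough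
    where
    unused? = λ (v : Fin n) → ¬? (v ∈? vs)
    unused = filter unused? (allFin n)
    unused! : Unique unused
    unused! = Unique.filter⁺ unused? (Unique.allFin⁺ n)
    covered : allFin n ⊆ vs ++ unused
    covered {v} v∈allFin with v ∈? vs
    ... | yes v∈vs = ∈-++⁺ˡ v∈vs
    ... | no  v∉vs = ∈-++⁺ʳ vs (∈-filter⁺ unused? v∈allFin v∉vs)
    enough : 2 ≤ length unused
    enough = +-cancelˡ-≤ (length vs) 2 (length unused)
               (≤-trans len (subst (n ≤_) (length-++ vs) (allFin⊆⇒n≤length covered)))
    first-two : (us : List (Fin n)) → Unique us → All (_∉ vs) us → 2 ≤ length us →
                ∃[ a ] ∃[ b ] a ≢ b × a ∉ vs × b ∉ vs
    first-two (a ∷ b ∷ _) ((a≢b ∷ _) ∷ _) (a∉ ∷ b∉ ∷ _) _ = a , b , a≢b , a∉ , b∉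
    first-two (_ ∷ []) _ _ (s≤s ())

module _ {n : ℕ} (a b : Fin n) where

  transpose-matchˡ : PC.transpose a b a ≡ b
  transpose-matchˡ rewrite dec-true (a ≟ a) refl = refl

  transpose-fixes : ∀ {v} → v ≢ a → v ≢ b → PC.transpose a b v ≡ v
  transpose-fixes {v} v≢a v≢b rewrite dec-false (v ≟ a) v≢a | dec-false (v ≟ b) v≢b = refl

  transpose-fixes-∉ : ∀ {vs} → a ∉ vs → b ∉ vs → All (λ v → PC.transpose a b v ≡ v) vs
  transpose-fixes-∉ a∉vs b∉vs = All.tabulate λ v∈vs →
    transpose-fixes (λ { refl → a∉vs v∈vs }) (λ { refl → b∉vs v∈vs })

groups : List (List ℕ)
groups = rows ++ circles

valid⇒distinct : ∀ {s} → ValidBoard s → All (Distinct s) groups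
valid⇒distinct (rows! , circles!) = All-++⁺ rows! circles!

relabel-distinct : (π : Permutation′ 7) {s : Board} (g : List ℕ) → Distinct s g → Distinct ((π ⟨$⟩ʳ_) ∘ s) g
relabel-distinct π g s! = subst Unique (sym (map-∘ (map toCell g))) (Unique.map⁺ π-injective s!)
  where
  π-injective : ∀ {x y} → π ⟨$⟩ʳ x ≡ π ⟨$⟩ʳ y → x ≡ y
  π-injective {x} {y} πx≡πy = trans (sym (inverseˡ π)) (trans (cong (π ⟨$⟩ˡ_) πx≡πy) (inverseˡ π))

relabel-valid : (π : Permutation′ 7) {s : Board} → ValidBoard s → ValidBoard ((π ⟨$⟩ʳ_) ∘ s)
relabel-valid π (rows! , circles!) = All.map (relabel-distinct π _) rows! , All.map (relabel-distinct π _) circles!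

relabel-extends : (f : Value → Value) {s : Board} (p : Puzzle) →
                  All (λ v → f v ≡ v) (map proj₂ p) → Extends s p → Extends (f ∘ s) p
relabel-extends f []      []             []           = []
relabel-extends f (_ ∷ p) (fv≡v ∷ fixes) (sc≡v ∷ ext) = trans (cong f sc≡v) fv≡v ∷ relabel-extends f p fixes ext

-- A circle has seven cells, so it carries all seven values.
valid⇒surjective : ∀ {s} → ValidBoard s → ∀ v → ∃[ c ] s c ≡ v
valid⇒surjective {s} (_ , circle! ∷ _) v with ∈-map⁻ s (Unique∧length≡⇒∈ circle! refl v)
... | c , _ , v≡sc = c , sym v≡sc

two-unused⇒¬unique : (p : Puzzle) {a b : Value} → a ≢ b → a ∉ map proj₂ p → b ∉ map proj₂ p →
                     ¬ HasUniqueSolution p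
two-unused⇒¬unique p {a} {b} a≢b a∉p b∉p (s , (valid , extends) , unique) = a≢b a≡b
  where
  open ≡-Reasoning
  τ = transpose a b
  τs-solution : Solution p ((τ ⟨$⟩ʳ_) ∘ s)
  τs-solution = relabel-valid τ valid , relabel-extends (τ ⟨$⟩ʳ_) p (transpose-fixes-∉ a b a∉p b∉p) extends
  c = proj₁ (valid⇒surjective valid a)
  sc≡a = proj₂ (valid⇒surjective valid a)
  a≡b : a ≡ b
  a≡b = begin
    a                ≡⟨ sym sc≡a ⟩
    s c              ≡⟨ sym (unique _ τs-solution c) ⟩
    τ ⟨$⟩ʳ (s c)     ≡⟨ cong (τ ⟨$⟩ʳ_) sc≡a ⟩
    τ ⟨$⟩ʳ a         ≡⟨ transpose-matchˡ a b ⟩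
    b                ∎

few-seeds⇒¬unique : (p : Puzzle) → length p ≤ 5 → ¬ HasUniqueSolution p
few-seeds⇒¬unique p len = apply (two-∉ (map proj₂ p) (+-monoˡ-≤ 2 (subst (_≤ 5) (sym (length-map proj₂ p)) len)))
  where
  apply : ∃[ a ] ∃[ b ] a ≢ b × a ∉ map proj₂ p × b ∉ map proj₂ p → ¬ HasUniqueSolution p
  apply (_ , _ , a≢b , a∉p , b∉p) = two-unused⇒¬unique p a≢b a∉p b∉p

Peers : ℕ → ℕ → Set
Peers c d = c ≢ d × Any (λ g → c ∈ g × d ∈ g) groups

peers? : (c d : ℕ) → Dec (Peers c d)
peers? c d = ¬? (c ℕ.≟ d) ×-dec Any.any? (λ g → (c ℕ∈? g) ×-dec (d ℕ∈? g)) groups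

peers⇒≢ : ∀ {s c d} → ValidBoard s → Peers c d → s (toCell c) ≢ s (toCell d)
peers⇒≢ {s} {c} {d} valid (c≢d , in-group) = All.lookupWith distinct (valid⇒distinct valid) in-group
  where
  distinct : ∀ {g} → Distinct s g → c ∈ g × d ∈ g → s (toCell c) ≢ s (toCell d)
  distinct {g} g! (c∈g , d∈g) = Unique-map⇒≢ (s ∘ toCell) (subst Unique (sym (map-∘ g)) g!) c∈g d∈g c≢d

Agrees : Board → Board → List ℕ → Set
Agrees t s = All (λ c → t (toCell c) ≡ s (toCell c))

-- The naked-single rule of sudoku, with K the cells already known to carry their value in s.
Forced : Board → List ℕ → ℕ → Set
Forced s K c = ∀ w → w ≡ s (toCell c) ⊎ Any (λ d → s (toCell d) ≡ w × Peers c d) K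

ForcedInOrder : Board → List ℕ → List ℕ → Set
ForcedInOrder s K []       = ⊤
ForcedInOrder s K (c ∷ cs) = Forced s K c × ForcedInOrder s (c ∷ K) cs

forced? : ∀ s K c → Dec (Forced s K c)
forced? s K c = all? λ w → (w ≟ s (toCell c)) ⊎-dec Any.any? (λ d → (s (toCell d) ≟ w) ×-dec peers? c d) K

forcedInOrder? : ∀ s K cs → Dec (ForcedInOrder s K cs)
forcedInOrder? s K []       = yes tt
forcedInOrder? s K (c ∷ cs) = forced? s K c ×-dec forcedInOrder? s (c ∷ K) cs

forced-sound : ∀ {t s K c} → ValidBoard t → Agrees t s K → Forced s K c → t (toCell c) ≡ s (toCell c)
forced-sound {t} {s} {K} {c} valid agrees forced with forced (t (toCell c))
... | inj₁ tc≡sc    = tc≡sc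
... | inj₂ excluded = ⊥-elim (All.lookupWith clash agrees excluded)
  where
  clash : ∀ {d} → t (toCell d) ≡ s (toCell d) → s (toCell d) ≡ t (toCell c) × Peers c d → ⊥
  clash td≡sd (sd≡tc , peers) = peers⇒≢ valid peers (sym (trans td≡sd sd≡tc))

forcedInOrder-sound : ∀ {t s K} cs → ValidBoard t → Agrees t s K → ForcedInOrder s K cs → Agrees t s cs
forcedInOrder-sound []       _     _      _                  = []
forcedInOrder-sound {t} {s} (c ∷ cs) valid agrees (forced , forced*) =
  tc≡sc ∷ forcedInOrder-sound {s = s} cs valid (tc≡sc ∷ agrees) forced*
  where
  tc≡sc : t (toCell c) ≡ s (toCell c)
  tc≡sc = forced-sound {s = s} valid agrees forced

distinct? : ∀ s g → Dec (Distinct s g)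
distinct? s g = DecUnique.unique? _≟_ (map s (map toCell g))

validBoard? : ∀ s → Dec (ValidBoard s)
validBoard? s = All.all? (distinct? s) rows ×-dec All.all? (distinct? s) circles

restrict : Board → List ℕ → Puzzle
restrict s = map (λ c → toCell c , s (toCell c))

restrict-extends : ∀ s cs → Extends s (restrict s cs)
restrict-extends s cs = All-map⁺ (All.universal (λ _ → refl) cs)

extends-restrict⇒agrees : ∀ {t} s cs → Extends t (restrict s cs) → Agrees t s cs
extends-restrict⇒agrees s cs = All-map⁻

toCell-suc-toℕ : ∀ c → toCell (suc (toℕ c)) ≡ c
toCell-suc-toℕ c with toℕ c ℕ.<? 37
... | yes c<37 = fromℕ<-toℕ c c<37
... | no  c≮37 = ⊥-elim (c≮37 (toℕ<n c))

forced⇒determined : ∀ {t s} seeds order → ValidBoard t → Agrees t s seeds → ForcedInOrder s seeds order →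
                    (∀ c → suc (toℕ c) ∈ seeds ++ order) → ∀ c → t c ≡ s c
forced⇒determined {t} {s} seeds order valid agrees forced covers c =
  subst (λ c′ → t c′ ≡ s c′) (toCell-suc-toℕ c)
        (All.lookup (All-++⁺ agrees (forcedInOrder-sound order valid agrees forced)) (covers c))

solution : Board
solution = Vec.lookup
  ( # 0 ∷ # 1 ∷ # 2 ∷ # 3
  ∷ # 2 ∷ # 3 ∷ # 4 ∷ # 5 ∷ # 6
  ∷ # 4 ∷ # 5 ∷ # 6 ∷ # 0 ∷ # 1 ∷ # 2
  ∷ # 6 ∷ # 0 ∷ # 1 ∷ # 2 ∷ # 3 ∷ # 4 ∷ # 5
  ∷ # 2 ∷ # 3 ∷ # 4 ∷ # 5 ∷ # 6 ∷ # 0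
  ∷ # 5 ∷ # 6 ∷ # 0 ∷ # 1 ∷ # 2
  ∷ # 1 ∷ # 2 ∷ # 3 ∷ # 4 ∷ [] )

seedCells : List ℕ
seedCells = 2 ∷ 7 ∷ 17 ∷ 19 ∷ 26 ∷ 27 ∷ []

deductionOrder : List ℕ
deductionOrder = 20 ∷ 13 ∷ 33 ∷ 12 ∷ 18 ∷ 25 ∷ 31 ∷ 36 ∷ 6 ∷ 23 ∷ 24 ∷ 29 ∷ 1 ∷ 3 ∷ 11 ∷ 14 ∷ 28 ∷ 5 ∷ 9 ∷ 10 ∷
                 15 ∷ 16 ∷ 34 ∷ 35 ∷ 37 ∷ 8 ∷ 21 ∷ 22 ∷ 30 ∷ 32 ∷ 4 ∷ []

puzzle : Puzzle
puzzle = restrict solution seedCells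

unique-solution : HasUniqueSolution puzzle
unique-solution = solution , (from-yes (validBoard? solution) , restrict-extends solution seedCells) , determined
  where
  covered : (c : Cell) → suc (toℕ c) ∈ seedCells ++ deductionOrder
  covered = from-yes (all? {n = 37} (λ c → suc (toℕ c) ℕ∈? (seedCells ++ deductionOrder)))
  determined : ∀ t → Solution puzzle t → ∀ c → t c ≡ solution c
  determined t (valid , extends) = forced⇒determined seedCells deductionOrder valid
    (extends-restrict⇒agrees solution seedCells extends)
    (from-yes (forcedInOrder? solution seedCells deductionOrder))
    covered

theorem6 : ((p : Puzzle) → WellFormed p → length p ≤ 5 → ¬ HasUniqueSolution p)
    × Σ Puzzle (λ p → WellFormed p × length p ≡ 6 × HasUniqueSolution p)
theorem6 = (λ p _ → few-seeds⇒¬unique p)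
         , puzzle , from-yes (DecUnique.unique? _≟_ (map proj₁ puzzle)) , refl , unique-solution
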